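{- Let $L$ be a residuated lattice with $\mathrm{Rad}(L)=\{1\}$. Then $\mathrm{Soc}(L)=\{a\in L\mid U_{Max}(a)\text{ is a finite set}\}$.
   Context: A residuated lattice is an algebra $(L,\wedge,\vee,\odot,\rightarrow,0,1)$ such that $(L,\wedge,\vee,0,1)$ is a bounded lattice, $(L,\odot,1)$ is a commutative monoid, and $x\odot z\le y$ iff $z\le x\rightarrow y$. A filter is a nonempty subset closed under $\odot$ and upward closed. A filter $T$ is simple if $T\neq\{1\}$ and the only filters contained in $T$ are $\{1\}$ and $T$. $\mathrm{Soc}(L)$ is the smallest filter containing all simple filters of $L$ if there is at least one, and $\{1\}$ otherwise. $Max(L)$ is the set of maximal filters; $\mathrm{Rad}(L)=\bigcap Max(L)$; for $a\in L$, $U_{Max}(a):=\{M\in Max(L)\mid a\notin M\}$. -}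

module Defs where

open import Level using (Level; _⊔_) renaming (suc to lsuc)
open import Data.Nat using (ℕ)
open import Data.Fin using (Fin)
open import Data.Unit.Polymorphic using (⊤)
open import Data.Product using (Σ; ∃; ∃-syntax; _×_; _,_)
open import Data.Sum using (_⊎_)
open import Relation.Nullary using (¬_)
open import Relation.Unary using (Pred; _⊆_; _≐_; _∈_; _∉_)
open import Relation.Binary.PropositionalEquality using (_≡_)
open import Algebra.Core using (Op₂)
open import Algebra.Structures using (IsCommutativeMonoid)
open import Algebra.Lattice.Structures using (IsLattice)
open import Function.Bundles using (_⇔_)

record ResiduatedLattice (ℓ : Level) : Set (lsuc ℓ) where
  infixr 7 _⊙_
  infixr 6 _∧_
  infixr 5 _∨_
  infixr 4 _⇒_
  infix 3 _≤_
  field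
    Carrier : Set ℓ
    _∧_ _∨_ _⊙_ _⇒_ : Op₂ Carrier
    0# 1# : Carrier

  _≤_ : Carrier → Carrier → Set ℓ
  x ≤ y = x ∧ y ≡ x

  field
    isLattice : IsLattice _≡_ _∨_ _∧_
    0-least : ∀ x → 0# ≤ x
    1-greatest : ∀ x → x ≤ 1#
    ⊙-isCommutativeMonoid : IsCommutativeMonoid _≡_ _⊙_ 1#
    residuation : ∀ x y z → (x ⊙ z ≤ y) ⇔ (z ≤ x ⇒ y)

module _ {ℓ : Level} (L : ResiduatedLattice ℓ) where
  open ResiduatedLattice L

  One : Pred Carrier ℓ
  One x = x ≡ 1#

  Whole : Pred Carrier ℓ
  Whole _ = ⊤

  record IsFilter (F : Pred Carrier ℓ) : Set ℓ where
    field
      nonempty : ∃[ x ] F x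
      ⊙-closed : ∀ {x y} → F x → F y → F (x ⊙ y)
      up-closed : ∀ {x y} → F x → x ≤ y → F y

  IsSimple : Pred Carrier ℓ → Set (lsuc ℓ)
  IsSimple T = IsFilter T × ¬ (T ≐ One)
             × (∀ (G : Pred Carrier ℓ) → IsFilter G → G ⊆ T → (G ≐ One) ⊎ (G ≐ T))

  IsMaximal : Pred Carrier ℓ → Set (lsuc ℓ)
  IsMaximal M = IsFilter M × ¬ (M ≐ Whole)
              × (∀ (G : Pred Carrier ℓ) → IsFilter G → M ⊆ G → (G ≐ M) ⊎ (G ≐ Whole))

  Rad : Pred Carrier (lsuc ℓ)
  Rad a = ∀ (M : Pred Carrier ℓ) → IsMaximal M → a ∈ M

  -- Soc(L): the smallest filter containing all simple filters (i.e. the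
  -- intersection of all filters containing every simple filter) if there is
  -- at least one simple filter, and {1} otherwise.
  Soc : Pred Carrier (lsuc ℓ)
  Soc a = ((∃[ T ] IsSimple T) →
             ∀ (G : Pred Carrier ℓ) → IsFilter G →
               (∀ (T : Pred Carrier ℓ) → IsSimple T → T ⊆ G) → a ∈ G)
        × (¬ (∃[ T ] IsSimple T) → a ≡ 1#)

  UMax : Carrier → Pred Carrier ℓ → Set (lsuc ℓ)
  UMax a M = IsMaximal M × a ∉ M

  -- A collection 𝒰 of subsets of L (closed under extensional equality ≐)
  -- is finite if it is enumerated, up to ≐, by some Fin n → subsets.
  IsFiniteFamily : (Pred Carrier ℓ → Set (lsuc ℓ)) → Set (lsuc ℓ)
  IsFiniteFamily 𝒰 =
    ∃[ n ] Σ (Fin n → Pred Carrier ℓ) λ f →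
      ∀ (M : Pred Carrier ℓ) → 𝒰 M ⇔ (∃[ i ] M ≐ f i)

{-# OPTIONS --safe #-}
-- Every element of a simple filter lies outside at most one maximal filter,
-- and membership in Soc means lying above a finite product of such elements;
-- so an element of Soc lies outside only finitely many maximal filters.
-- Conversely, let a lie outside exactly M₁, …, Mₙ.  Maximal filters are prime,
-- so joining a with elements separating Mᵢ from the other Mⱼ gives cᵢ lying
-- outside Mᵢ and inside every other maximal filter.  Because Rad = {1},
-- ⟨ cᵢ ⟩ is then a simple filter, and cᵢ^kᵢ ⇒ 0 lies in Mᵢ for some kᵢ; so
-- x = ∏ cᵢ^kᵢ belongs to every filter containing the simple ones, while x ⇒ a
-- lies in every maximal filter, i.e. x ≤ a, again because Rad = {1}.
module Submission where

open import Defs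
open import Level using (Level; Lift; lift; lower) renaming (suc to lsuc)
open import Axiom.ExcludedMiddle using (ExcludedMiddle)
open import Algebra.Bundles using (CommutativeMonoid)
open import Algebra.Lattice.Bundles using (Lattice)
import Algebra.Lattice.Properties.Lattice as LatticeProperties
import Algebra.Properties.CommutativeSemigroup as CommutativeSemigroupProperties
import Algebra.Properties.Monoid.Mult as MonoidMultProperties
import Relation.Binary.Lattice as OrderTheoretic
open import Data.Fin using (Fin; zero; suc)
open import Data.List using (List; []; _∷_; [_]; _++_)
open import Data.List.Relation.Unary.Any using (Any; here; there)
open import Data.List.Relation.Unary.Any.Properties using (++⁺ˡ; ++⁺ʳ)
open import Data.Nat using (ℕ; zero; suc; _+_)
open import Data.Nat.Properties using (+-suc)
open import Data.Product using (∃-syntax; _×_; _,_; proj₁; proj₂)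
open import Data.Sum using (_⊎_; inj₁; inj₂; [_,_]′; map₁)
open import Data.Unit.Polymorphic using (tt)
import Data.Vec.Functional as Vector
open import Function using (_∘_)
open import Function.Bundles using (_⇔_; mk⇔; Equivalence)
open import Relation.Binary.PropositionalEquality using (_≡_; _≢_; refl; sym; subst; subst₂)
open import Relation.Nullary using (¬_; Dec; yes; no; contradiction)
open import Relation.Nullary.Decidable using (map′; decidable-stable)
open import Relation.Unary using (Pred; _⊆_; _≐_; _∈_; _∉_; _∩_)
open import Relation.Unary.Properties using (≐-refl; ≐-sym; ≐-trans)

module _ {ℓ : Level} (L : ResiduatedLattice ℓ) where
  open ResiduatedLattice L
  open IsFilter

  private variable
    a c x y z u v w : Carrier
    F G M M′ : Pred Carrier ℓ
    𝒰 : Pred Carrier ℓ → Set (lsuc ℓ)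

  -- Order, residuation and powers

  ∧∨-lattice : Lattice ℓ ℓ
  ∧∨-lattice = record
    { Carrier = Carrier ; _≈_ = _≡_ ; _∨_ = _∨_ ; _∧_ = _∧_ ; isLattice = isLattice }

  -- The library's natural order is x ≡ x ∧ y, the symmetric form of _≤_.
  private
    module Natural =
      OrderTheoretic.Lattice (LatticeProperties.∨-∧-orderTheoreticLattice ∧∨-lattice)

  ≤-refl : x ≤ x
  ≤-refl = sym Natural.refl

  ≤-reflexive : x ≡ y → x ≤ y
  ≤-reflexive refl = ≤-refl

  ≤-trans : x ≤ y → y ≤ z → x ≤ z
  ≤-trans p q = sym (Natural.trans (sym p) (sym q))

  ≤-antisym : x ≤ y → y ≤ x → x ≡ y
  ≤-antisym p q = Natural.antisym (sym p) (sym q)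

  x≤x∨y : x ≤ x ∨ y
  x≤x∨y = sym (Natural.x≤x∨y _ _)

  y≤x∨y : y ≤ x ∨ y
  y≤x∨y = sym (Natural.y≤x∨y _ _)

  ∨-least : x ≤ z → y ≤ z → x ∨ y ≤ z
  ∨-least p q = sym (Natural.∨-least (sym p) (sym q))

  ⊙-commutativeMonoid : CommutativeMonoid ℓ ℓ
  ⊙-commutativeMonoid = record
    { Carrier = Carrier ; _≈_ = _≡_ ; _∙_ = _⊙_ ; ε = 1#
    ; isCommutativeMonoid = ⊙-isCommutativeMonoid }

  open CommutativeMonoid ⊙-commutativeMonoid using (comm; identityˡ; identityʳ)
  open CommutativeSemigroupProperties (CommutativeMonoid.commutativeSemigroup ⊙-commutativeMonoid)
    using (interchange)
  open MonoidMultProperties (CommutativeMonoid.monoid ⊙-commutativeMonoid)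
    using (×-homo-+) renaming (_×_ to power)

  infixr 8 _^_
  _^_ : Carrier → ℕ → Carrier
  x ^ n = power n x

  ^-+ : ∀ x k l → x ^ (k + l) ≡ x ^ k ⊙ x ^ l
  ^-+ x k l = ×-homo-+ x k l

  residual-intro : x ⊙ z ≤ y → z ≤ x ⇒ y
  residual-intro = Equivalence.to (residuation _ _ _)

  residual-elim : z ≤ x ⇒ y → x ⊙ z ≤ y
  residual-elim = Equivalence.from (residuation _ _ _)

  x⊙[x⇒y]≤y : x ⊙ (x ⇒ y) ≤ y
  x⊙[x⇒y]≤y = residual-elim ≤-refl

  ⊙-monoʳ-≤ : x ≤ y → z ⊙ x ≤ z ⊙ y
  ⊙-monoʳ-≤ p = residual-elim (≤-trans p (residual-intro ≤-refl))

  ⊙-monoˡ-≤ : x ≤ y → x ⊙ z ≤ y ⊙ z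
  ⊙-monoˡ-≤ {x} {y} {z} p = subst₂ _≤_ (comm z x) (comm z y) (⊙-monoʳ-≤ p)

  ⊙-mono-≤ : x ≤ y → z ≤ w → x ⊙ z ≤ y ⊙ w
  ⊙-mono-≤ p q = ≤-trans (⊙-monoˡ-≤ p) (⊙-monoʳ-≤ q)

  x⊙y≤x : x ⊙ y ≤ x
  x⊙y≤x {x} = subst (x ⊙ _ ≤_) (identityʳ x) (⊙-monoʳ-≤ (1-greatest _))

  x⊙y≤y : x ⊙ y ≤ y
  x⊙y≤y {x} {y} = subst (_≤ y) (comm y x) x⊙y≤x

  ⊙-∨-≤ : z ⊙ x ≤ u → z ⊙ y ≤ v → z ⊙ (x ∨ y) ≤ u ∨ v
  ⊙-∨-≤ p q = residual-elim (∨-least (residual-intro (≤-trans p x≤x∨y))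
                                       (residual-intro (≤-trans q y≤x∨y)))

  ∨-⊙-least : x ⊙ z ≤ u → y ⊙ z ≤ u → (x ∨ y) ⊙ z ≤ u
  ∨-⊙-least {x} {z} {u} {y} p q =
    subst (_≤ u) (comm z (x ∨ y))
      (residual-elim (∨-least (residual-intro (subst (_≤ u) (comm x z) p))
                               (residual-intro (subst (_≤ u) (comm y z) q))))

  ⇒-monoʳ-≤ : y ≤ z → x ⇒ y ≤ x ⇒ z
  ⇒-monoʳ-≤ p = residual-intro (≤-trans x⊙[x⇒y]≤y p)

  ⇒-antitoneˡ-≤ : x ≤ y → y ⇒ z ≤ x ⇒ z
  ⇒-antitoneˡ-≤ p = residual-intro (≤-trans (⊙-monoˡ-≤ p) x⊙[x⇒y]≤y)

  ⇒-⊙-≤ : (x ⇒ y) ⊙ (z ⇒ w) ≤ x ⊙ z ⇒ y ⊙ w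
  ⇒-⊙-≤ {x} {y} {z} {w} = residual-intro
    (subst (_≤ y ⊙ w) (sym (interchange x z (x ⇒ y) (z ⇒ w))) (⊙-mono-≤ x⊙[x⇒y]≤y x⊙[x⇒y]≤y))

  ⇒-∨-≤ : (x ⇒ z) ⊙ (y ⇒ z) ≤ x ∨ y ⇒ z
  ⇒-∨-≤ = residual-intro (∨-⊙-least (≤-trans (⊙-monoʳ-≤ x⊙y≤x) x⊙[x⇒y]≤y)
                                    (≤-trans (⊙-monoʳ-≤ x⊙y≤y) x⊙[x⇒y]≤y))

  x≤y⇒1≤[x⇒y] : x ≤ y → 1# ≤ x ⇒ y
  x≤y⇒1≤[x⇒y] p = residual-intro (≤-trans x⊙y≤x p)

  1≤[x⇒y]⇒x≤y : 1# ≤ x ⇒ y → x ≤ y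
  1≤[x⇒y]⇒x≤y {x} {y} p = subst (_≤ y) (identityʳ x) (residual-elim p)

  ^-∨-≤ : ∀ k l → (x ∨ y) ^ (k + l) ≤ x ^ k ∨ y ^ l
  ^-∨-≤ zero l = ≤-trans (1-greatest _) x≤x∨y
  ^-∨-≤ (suc k) zero = ≤-trans (1-greatest _) y≤x∨y
  ^-∨-≤ {x} {y} (suc k) (suc l) = ∨-⊙-least left right
    where
    left : x ⊙ (x ∨ y) ^ (k + suc l) ≤ x ^ suc k ∨ y ^ suc l
    left = ≤-trans (⊙-monoʳ-≤ (^-∨-≤ k (suc l))) (⊙-∨-≤ ≤-refl x⊙y≤y)
    right : y ⊙ (x ∨ y) ^ (k + suc l) ≤ x ^ suc k ∨ y ^ suc l
    right rewrite +-suc k l = ≤-trans (⊙-monoʳ-≤ (^-∨-≤ (suc k) l)) (⊙-∨-≤ x⊙y≤y ≤-refl)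

  -- Filters

  1∈filter : IsFilter L F → 1# ∈ F
  1∈filter F-filter = let x , x∈F = nonempty F-filter in up-closed F-filter x∈F (1-greatest x)

  ^-closed : IsFilter L F → x ∈ F → ∀ k → x ^ k ∈ F
  ^-closed F-filter x∈F zero = 1∈filter F-filter
  ^-closed F-filter x∈F (suc k) = ⊙-closed F-filter x∈F (^-closed F-filter x∈F k)

  ∉⇒≢1 : IsFilter L F → x ∉ F → x ≢ 1#
  ∉⇒≢1 F-filter x∉F refl = x∉F (1∈filter F-filter)

  One-isFilter : IsFilter L (One L)
  One-isFilter = record
    { nonempty = 1# , refl
    ; ⊙-closed = λ { refl refl → identityʳ 1# }
    ; up-closed = λ { refl 1≤y → ≤-antisym (1-greatest _) 1≤y }
    }

  IsFilter-resp-≐ : F ≐ G → IsFilter L G → IsFilter L F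
  IsFilter-resp-≐ (F⊆G , G⊆F) G-filter = record
    { nonempty = let x , x∈G = nonempty G-filter in x , G⊆F x∈G
    ; ⊙-closed = λ x∈F y∈F → G⊆F (⊙-closed G-filter (F⊆G x∈F) (F⊆G y∈F))
    ; up-closed = λ x∈F x≤y → G⊆F (up-closed G-filter (F⊆G x∈F) x≤y)
    }

  IsMaximal-resp-≐ : M ≐ M′ → IsMaximal L M′ → IsMaximal L M
  IsMaximal-resp-≐ M≐M′ (M′-filter , M′≉Whole , M′-maximal) =
    IsFilter-resp-≐ M≐M′ M′-filter ,
    (λ M≐Whole → M′≉Whole (≐-trans (≐-sym M≐M′) M≐Whole)) ,
    λ G G-filter M⊆G → map₁ (λ G≐M′ → ≐-trans G≐M′ (≐-sym M≐M′))
                         (M′-maximal G G-filter (λ x∈M′ → M⊆G (proj₂ M≐M′ x∈M′)))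

  0∉maximal : IsMaximal L M → 0# ∉ M
  0∉maximal (M-filter , M≉Whole , _) 0∈M =
    M≉Whole ((λ _ → tt) , λ _ → up-closed M-filter 0∈M (0-least _))

  -- Maximal filters

  -- The filter generated by F ∪ {x}.
  Adjoin : Pred Carrier ℓ → Carrier → Pred Carrier ℓ
  Adjoin F x y = ∃[ k ] (x ^ k ⇒ y) ∈ F

  ⊆-Adjoin : IsFilter L F → F ⊆ Adjoin F x
  ⊆-Adjoin F-filter y∈F = 0 , up-closed F-filter y∈F (residual-intro (≤-reflexive (identityˡ _)))

  ∈-Adjoin : IsFilter L F → x ∈ Adjoin F x
  ∈-Adjoin F-filter = 1 , up-closed F-filter (1∈filter F-filter) (x≤y⇒1≤[x⇒y] x⊙y≤x)

  Adjoin-isFilter : IsFilter L F → IsFilter L (Adjoin F x)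
  Adjoin-isFilter {F} {x} F-filter = record
    { nonempty = 1# , ⊆-Adjoin F-filter (1∈filter F-filter)
    ; ⊙-closed = λ { {y} {z} (k , p) (l , q) →
        k + l , up-closed F-filter (⊙-closed F-filter p q)
                  (subst (λ t → (x ^ k ⇒ y) ⊙ (x ^ l ⇒ z) ≤ t ⇒ y ⊙ z) (sym (^-+ x k l)) ⇒-⊙-≤) }
    ; up-closed = λ { (k , p) y≤z → k , up-closed F-filter p (⇒-monoʳ-≤ y≤z) }
    }

  maximal-∉⇒[x^k⇒0]∈ : IsMaximal L M → x ∉ M → ∃[ k ] (x ^ k ⇒ 0#) ∈ M
  maximal-∉⇒[x^k⇒0]∈ (M-filter , _ , M-maximal) x∉M
    with M-maximal _ (Adjoin-isFilter M-filter) (⊆-Adjoin M-filter)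
  ... | inj₁ (Adjoin⊆M , _) = contradiction (Adjoin⊆M (∈-Adjoin M-filter)) x∉M
  ... | inj₂ (_ , Whole⊆Adjoin) = Whole⊆Adjoin tt

  maximal-prime : IsMaximal L M → x ∉ M → y ∉ M → x ∨ y ∉ M
  maximal-prime {M} {x} {y} M-max x∉M y∉M x∨y∈M
    with maximal-∉⇒[x^k⇒0]∈ M-max x∉M | maximal-∉⇒[x^k⇒0]∈ M-max y∉M
  ... | k , [xᵏ⇒0]∈M | l , [yˡ⇒0]∈M =
    0∉maximal M-max (up-closed M-filter
      (⊙-closed M-filter (^-closed M-filter x∨y∈M (k + l)) (⊙-closed M-filter [xᵏ⇒0]∈M [yˡ⇒0]∈M))
      (residual-elim (≤-trans ⇒-∨-≤ (⇒-antitoneˡ-≤ (^-∨-≤ k l)))))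
    where M-filter = proj₁ M-max

  [x⇒0]∈-antitone : IsFilter L F → x ≤ y → (y ⇒ 0#) ∈ F → (x ⇒ 0#) ∈ F
  [x⇒0]∈-antitone F-filter x≤y [y⇒0]∈F = up-closed F-filter [y⇒0]∈F (⇒-antitoneˡ-≤ x≤y)

  -- Principal filters and simple filters

  ⟨_⟩ : Carrier → Pred Carrier ℓ
  ⟨ c ⟩ y = ∃[ k ] c ^ k ≤ y

  ⟨⟩-isFilter : IsFilter L ⟨ c ⟩
  ⟨⟩-isFilter {c} = record
    { nonempty = 1# , 0 , ≤-refl
    ; ⊙-closed = λ { (k , p) (l , q) → k + l , subst (_≤ _) (sym (^-+ c k l)) (⊙-mono-≤ p q) }
    ; up-closed = λ { (k , p) y≤z → k , ≤-trans p y≤z }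
    }

  ≤⇒∈⟨⟩ : c ≤ y → y ∈ ⟨ c ⟩
  ≤⇒∈⟨⟩ c≤y = 1 , ≤-trans x⊙y≤x c≤y

  x∈⟨x⟩ : x ∈ ⟨ x ⟩
  x∈⟨x⟩ = ≤⇒∈⟨⟩ ≤-refl

  ⟨⟩-least : IsFilter L F → c ∈ F → ⟨ c ⟩ ⊆ F
  ⟨⟩-least F-filter c∈F (k , cᵏ≤y) = up-closed F-filter (^-closed F-filter c∈F k) cᵏ≤y

  data Generated (P : Pred Carrier ℓ) : Pred Carrier ℓ where
    gen  : x ∈ P → Generated P x
    unit : Generated P 1#
    _∙_  : Generated P x → Generated P y → Generated P (x ⊙ y)
    up   : Generated P x → x ≤ y → Generated P y

  Generated-isFilter : ∀ {P} → IsFilter L (Generated P)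
  Generated-isFilter = record { nonempty = 1# , unit ; ⊙-closed = _∙_ ; up-closed = up }

  -- A substitute for "x lies in a simple filter" (see simple⇒atomic and
  -- atomic⇒simple) that lives in Set ℓ, so that the filter generated by such
  -- elements can be used as a witness in Soc.
  Atomic : Pred Carrier ℓ
  Atomic x = ∀ {y} → y ∈ ⟨ x ⟩ → y ≢ 1# → x ∈ ⟨ y ⟩

  simple⇒atomic : ∀ {T} → IsSimple L T → T ⊆ Atomic
  simple⇒atomic {T} (T-filter , _ , T-minimal) x∈T {y} y∈⟨x⟩ y≢1
    with T-minimal ⟨ y ⟩ ⟨⟩-isFilter (⟨⟩-least T-filter (⟨⟩-least T-filter x∈T y∈⟨x⟩))
  ... | inj₁ (⟨y⟩⊆One , _) = contradiction (⟨y⟩⊆One x∈⟨x⟩) y≢1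
  ... | inj₂ (_ , T⊆⟨y⟩) = T⊆⟨y⟩ x∈T

  Soc-intro : (∀ {G} → IsFilter L G → (∀ T → IsSimple L T → T ⊆ G) → a ∈ G) → Soc L a
  Soc-intro a∈G = (λ _ G G-filter simples⊆G → a∈G G-filter simples⊆G) ,
                  λ ∄T → a∈G One-isFilter λ T T-simple → contradiction (T , T-simple) ∄T

  filter-meets-finitely-many : ∀ {n q} {Q : Fin n → Pred Carrier q} → IsFilter L F →
    (∀ i {x y} → x ≤ y → Q i y → Q i x) → (∀ i → ∃[ x ] x ∈ F × Q i x) →
    ∃[ x ] x ∈ F × (∀ i → Q i x)
  filter-meets-finitely-many {n = zero} F-filter _ _ = 1# , 1∈filter F-filter , λ ()
  filter-meets-finitely-many {n = suc n} F-filter Q-antitone witness =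
    let x₀ , x₀∈F , Q₀x₀ = witness zero
        x , x∈F , Qx = filter-meets-finitely-many F-filter (Q-antitone ∘ suc) (witness ∘ suc)
    in x₀ ⊙ x , ⊙-closed F-filter x₀∈F x∈F ,
       λ { zero → Q-antitone zero x⊙y≤x Q₀x₀ ; (suc i) → Q-antitone (suc i) x⊙y≤y (Qx i) }

  Isolates : Carrier → Pred Carrier ℓ → Set (lsuc ℓ)
  Isolates c M = c ∉ M × (∀ {M′} → IsMaximal L M′ → ¬ M′ ≐ M → c ∈ M′)

  _Covers_ : List (Pred Carrier ℓ) → (Pred Carrier ℓ → Set (lsuc ℓ)) → Set (lsuc ℓ)
  Ms Covers 𝒰 = ∀ {M} → 𝒰 M → Any (M ≐_) Ms

  module _ (em : ExcludedMiddle (lsuc ℓ)) where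

    dec : (P : Set ℓ) → Dec P
    dec P = map′ lower lift (em {Lift (lsuc ℓ) P})

    stable : {P : Set ℓ} → ¬ ¬ P → P
    stable = decidable-stable (dec _)

    ⊙-∉ : IsFilter L F → x ⊙ y ∉ F → x ∉ F ⊎ y ∉ F
    ⊙-∉ {F} {x} {y} F-filter x⊙y∉F with dec (x ∈ F) | dec (y ∈ F)
    ... | yes x∈F | yes y∈F = contradiction (⊙-closed F-filter x∈F y∈F) x⊙y∉F
    ... | no x∉F  | _       = inj₁ x∉F
    ... | yes _   | no y∉F  = inj₂ y∉F

    maximal-separation : IsMaximal L M → IsMaximal L M′ → ¬ M′ ≐ M → ∃[ y ] y ∈ M′ × y ∉ M
    maximal-separation {M} {M′} (M-filter , M≉Whole , _) (_ , _ , M′-maximal) M′≉M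
      with dec (∃[ y ] y ∈ M′ × y ∉ M)
    ... | yes separating = separating
    ... | no ∄y with M′-maximal M M-filter (λ y∈M′ → stable λ y∉M → ∄y (_ , y∈M′ , y∉M))
    ...   | inj₁ M≐M′ = contradiction (≐-sym M≐M′) M′≉M
    ...   | inj₂ M≐Whole = contradiction M≐Whole M≉Whole

    atomic-UMax-unique : x ∈ Atomic → UMax L x M → UMax L x M′ → M ≐ M′
    atomic-UMax-unique {x} {M} {M′} x-atomic (M-max , x∉M) (M′-max , x∉M′) with dec (M ≐ M′)
    ... | yes M≐M′ = M≐M′
    ... | no M≉M′ with maximal-separation M′-max M-max M≉M′
    ...   | y , y∈M , y∉M′ =
      contradiction (⟨⟩-least (proj₁ M-max) (up-closed (proj₁ M-max) y∈M y≤x∨y)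
                      (x-atomic (≤⇒∈⟨⟩ x≤x∨y) x∨y≢1)) x∉M
      where
      x∨y≢1 : x ∨ y ≢ 1#
      x∨y≢1 = ∉⇒≢1 (proj₁ M′-max) (maximal-prime M′-max x∉M′ y∉M′)

    atomic-UMax-covered : x ∈ Atomic → ∃[ Ms ] Ms Covers UMax L x
    atomic-UMax-covered {x} x-atomic with em {∃[ M ] UMax L x M}
    ... | yes (M₀ , u₀) = [ M₀ ] , λ u → here (atomic-UMax-unique x-atomic u u₀)
    ... | no ∄M = [] , λ u → contradiction (_ , u) ∄M

    Generated⇒UMax-covered : Generated Atomic a → ∃[ Ms ] Ms Covers UMax L a
    Generated⇒UMax-covered (gen x-atomic) = atomic-UMax-covered x-atomic
    Generated⇒UMax-covered unit =
      [] , λ (M-max , 1∉M) → contradiction (1∈filter (proj₁ M-max)) 1∉M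
    Generated⇒UMax-covered (p ∙ q)
      with Generated⇒UMax-covered p | Generated⇒UMax-covered q
    ... | Ms , Ms-covers | Ns , Ns-covers = Ms ++ Ns , λ (M-max , x⊙y∉M) →
      [ (λ x∉M → ++⁺ˡ (Ms-covers (M-max , x∉M)))
      , (λ y∉M → ++⁺ʳ Ms (Ns-covers (M-max , y∉M))) ]′ (⊙-∉ (proj₁ M-max) x⊙y∉M)
    Generated⇒UMax-covered (up p x≤y) with Generated⇒UMax-covered p
    ... | Ms , covers = Ms , λ (M-max , y∉M) →
      covers (M-max , λ x∈M → y∉M (up-closed (proj₁ M-max) x∈M x≤y))

    restriction-finite : (∀ {M M′} → M ≐ M′ → 𝒰 M′ → 𝒰 M) →
      ∀ Ms → IsFiniteFamily L (λ M → 𝒰 M × Any (M ≐_) Ms)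
    restriction-finite resp [] = 0 , (λ ()) , λ M → mk⇔ (λ { (_ , ()) }) (λ { (() , _) })
    restriction-finite {𝒰} resp (M₀ ∷ Ms) with restriction-finite resp Ms | em {𝒰 M₀}
    ... | n , f , enum | no ¬u₀ = n , f , λ M → mk⇔ (to M) (from M)
      where
      to : ∀ M → 𝒰 M × Any (M ≐_) (M₀ ∷ Ms) → ∃[ i ] M ≐ f i
      to M (u , here M≐M₀) = contradiction (resp (≐-sym M≐M₀) u) ¬u₀
      to M (u , there a) = Equivalence.to (enum M) (u , a)
      from : ∀ M → ∃[ i ] M ≐ f i → 𝒰 M × Any (M ≐_) (M₀ ∷ Ms)
      from M i = let u , a = Equivalence.from (enum M) i in u , there a
    ... | n , f , enum | yes u₀ = suc n , M₀ Vector.∷ f , λ M → mk⇔ (to M) (from M)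
      where
      to : ∀ M → 𝒰 M × Any (M ≐_) (M₀ ∷ Ms) → ∃[ i ] M ≐ (M₀ Vector.∷ f) i
      to M (u , here M≐M₀) = zero , M≐M₀
      to M (u , there a) = let i , M≐fi = Equivalence.to (enum M) (u , a) in suc i , M≐fi
      from : ∀ M → ∃[ i ] M ≐ (M₀ Vector.∷ f) i → 𝒰 M × Any (M ≐_) (M₀ ∷ Ms)
      from M (zero , M≐M₀) = resp M≐M₀ u₀ , here M≐M₀
      from M (suc i , M≐fi) = let u , a = Equivalence.from (enum M) (i , M≐fi) in u , there a

    covered⇒finite : (∀ {M M′} → M ≐ M′ → 𝒰 M′ → 𝒰 M) → ∀ {Ms} → Ms Covers 𝒰 →
      IsFiniteFamily L 𝒰
    covered⇒finite resp {Ms} covers with restriction-finite resp Ms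
    ... | n , f , enum =
      n , f , λ M → mk⇔ (λ u → Equivalence.to (enum M) (u , covers u))
                        (proj₁ ∘ Equivalence.from (enum M))

    UMax-resp-≐ : M ≐ M′ → UMax L a M′ → UMax L a M
    UMax-resp-≐ M≐M′ (M′-max , a∉M′) = IsMaximal-resp-≐ M≐M′ M′-max , a∉M′ ∘ proj₁ M≐M′

    Soc⇒Generated-Atomic : Soc L a → Generated Atomic a
    Soc⇒Generated-Atomic (below-simples , trivial) with em {∃[ T ] IsSimple L T}
    ... | yes ∃T = below-simples ∃T (Generated Atomic) Generated-isFilter
                     λ T T-simple → gen ∘ simple⇒atomic T-simple
    ... | no ∄T = subst (Generated Atomic) (sym (trivial ∄T)) unit

    Soc⇒UMax-finite : Soc L a → IsFiniteFamily L (UMax L a)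
    Soc⇒UMax-finite a∈Soc =
      let _ , covers = Generated⇒UMax-covered (Soc⇒Generated-Atomic a∈Soc)
      in covered⇒finite UMax-resp-≐ covers

    atomic⇒simple : x ∈ Atomic → x ≢ 1# → IsSimple L ⟨ x ⟩
    atomic⇒simple {x} x-atomic x≢1 = ⟨⟩-isFilter , (λ (⟨x⟩⊆One , _) → x≢1 (⟨x⟩⊆One x∈⟨x⟩)) , minimal
      where
      minimal : ∀ H → IsFilter L H → H ⊆ ⟨ x ⟩ → H ≐ One L ⊎ H ≐ ⟨ x ⟩
      minimal H H-filter H⊆⟨x⟩ with dec (∃[ y ] y ∈ H × y ≢ 1#)
      ... | yes (y , y∈H , y≢1) =
        inj₂ (H⊆⟨x⟩ , ⟨⟩-least H-filter (⟨⟩-least H-filter y∈H (x-atomic (H⊆⟨x⟩ y∈H) y≢1)))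
      ... | no ∄y = inj₁ ((λ y∈H → stable λ y≢1 → ∄y (_ , y∈H , y≢1)) ,
                          λ { refl → 1∈filter H-filter })

    isolating-∩⊆Rad : Isolates c M → M ∩ ⟨ c ⟩ ⊆ Rad L
    isolating-∩⊆Rad {M = M} (_ , c∈others) (x∈M , x∈⟨c⟩) M′ M′-max with dec (M′ ≐ M)
    ... | yes M′≐M = proj₂ M′≐M x∈M
    ... | no M′≉M = ⟨⟩-least (proj₁ M′-max) (c∈others M′-max M′≉M) x∈⟨c⟩

    finite-separation : ∀ {n} → IsMaximal L M → (f : Fin n → Pred Carrier ℓ) →
      (∀ i → IsMaximal L (f i)) → ∃[ s ] s ∉ M × (∀ i → ¬ f i ≐ M → s ∈ f i)
    finite-separation {M} {n = zero} M-max f _ = 0# , 0∉maximal M-max , λ ()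
    finite-separation {M} {n = suc n} M-max f f-max
      with dec (f zero ≐ M) | finite-separation M-max (f ∘ suc) (f-max ∘ suc)
    ... | yes f₀≐M | s , s∉M , s∈f =
      s , s∉M , λ { zero f₀≉M → contradiction f₀≐M f₀≉M ; (suc i) → s∈f i }
    ... | no f₀≉M | s , s∉M , s∈f with maximal-separation M-max (f-max zero) f₀≉M
    ...   | y , y∈f₀ , y∉M =
      y ∨ s , maximal-prime M-max y∉M s∉M ,
      λ { zero _ → up-closed (proj₁ (f-max zero)) y∈f₀ x≤x∨y
        ; (suc i) fᵢ≉M → up-closed (proj₁ (f-max (suc i))) (s∈f i fᵢ≉M) y≤x∨y }

    enumerated∈ : ∀ {n} {f : Fin n → Pred Carrier ℓ} → (∀ M → 𝒰 M ⇔ (∃[ i ] M ≐ f i)) →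
      ∀ i → 𝒰 (f i)
    enumerated∈ enum i = Equivalence.from (enum _) (i , ≐-refl)

    isolating-element : IsFiniteFamily L (UMax L a) → UMax L a M → ∃[ c ] Isolates c M
    isolating-element {a} {M} (_ , f , enum) (M-max , a∉M)
      with finite-separation M-max f (proj₁ ∘ enumerated∈ enum)
    ... | s , s∉M , s∈f = a ∨ s , maximal-prime M-max a∉M s∉M , a∨s∈others
      where
      a∨s∈others : ∀ {M′} → IsMaximal L M′ → ¬ M′ ≐ M → a ∨ s ∈ M′
      a∨s∈others {M′} M′-max M′≉M with dec (a ∈ M′)
      ... | yes a∈M′ = up-closed (proj₁ M′-max) a∈M′ x≤x∨y
      ... | no a∉M′ =
        let i , M′≐fᵢ = Equivalence.to (enum M′) (M′-max , a∉M′) in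
        up-closed (proj₁ M′-max) (proj₂ M′≐fᵢ (s∈f i (M′≉M ∘ ≐-trans M′≐fᵢ))) y≤x∨y

    module _ (rad : ∀ a → Rad L a ⇔ (a ≡ 1#)) where

      [x⇒y]∈Rad⇒x≤y : (x ⇒ y) ∈ Rad L → x ≤ y
      [x⇒y]∈Rad⇒x≤y x⇒y∈Rad = 1≤[x⇒y]⇒x≤y (≤-reflexive (sym (Equivalence.to (rad _) x⇒y∈Rad)))

      isolating⇒atomic : IsMaximal L M → Isolates c M → c ∈ Atomic
      isolating⇒atomic {M} {c} M-max isolates {y} y∈⟨c⟩ y≢1 =
        let j , [yʲ⇒0]∈M = maximal-∉⇒[x^k⇒0]∈ M-max y∉M
            yʲ⇒c∈M = up-closed (proj₁ M-max) [yʲ⇒0]∈M (⇒-monoʳ-≤ (0-least c))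
        in j , [x⇒y]∈Rad⇒x≤y (isolating-∩⊆Rad isolates (yʲ⇒c∈M , ≤⇒∈⟨⟩ (residual-intro x⊙y≤y)))
        where
        y∉M : y ∉ M
        y∉M y∈M = y≢1 (Equivalence.to (rad y) (isolating-∩⊆Rad isolates (y∈M , y∈⟨c⟩)))

      socle-refutes-isolated : IsFilter L G → (∀ T → IsSimple L T → T ⊆ G) →
        IsMaximal L M → Isolates c M → ∃[ x ] x ∈ G × (x ⇒ 0#) ∈ M
      socle-refutes-isolated {c = c} G-filter simples⊆G M-max isolates@(c∉M , _) =
        let k , [cᵏ⇒0]∈M = maximal-∉⇒[x^k⇒0]∈ M-max c∉M
            ⟨c⟩-simple = atomic⇒simple (isolating⇒atomic M-max isolates) (∉⇒≢1 (proj₁ M-max) c∉M)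
        in c ^ k , ^-closed G-filter (simples⊆G ⟨ c ⟩ ⟨c⟩-simple x∈⟨x⟩) k , [cᵏ⇒0]∈M

      refuted-outside⇒≤ : (∀ {M} → UMax L a M → (x ⇒ 0#) ∈ M) → x ≤ a
      refuted-outside⇒≤ {a} {x} refuted = [x⇒y]∈Rad⇒x≤y λ M M-max → case M M-max (dec (a ∈ M))
        where
        case : ∀ M → IsMaximal L M → Dec (a ∈ M) → (x ⇒ a) ∈ M
        case M M-max (yes a∈M) = up-closed (proj₁ M-max) a∈M (residual-intro x⊙y≤y)
        case M M-max (no a∉M) =
          up-closed (proj₁ M-max) (refuted (M-max , a∉M)) (⇒-monoʳ-≤ (0-least a))

      UMax-finite⇒Soc : IsFiniteFamily L (UMax L a) → Soc L a
      UMax-finite⇒Soc {a} finite@(_ , f , enum) = Soc-intro λ G-filter simples⊆G →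
        let x , x∈G , refuted = filter-meets-finitely-many G-filter
              (λ i → [x⇒0]∈-antitone (proj₁ (proj₁ (fᵢ-out i))))
              (λ i → socle-refutes-isolated G-filter simples⊆G (proj₁ (fᵢ-out i))
                       (proj₂ (isolating-element finite (fᵢ-out i))))
        in up-closed G-filter x∈G (refuted-outside⇒≤ λ u →
             let i , M≐fᵢ = Equivalence.to (enum _) u in proj₂ M≐fᵢ (refuted i))
        where
        fᵢ-out : ∀ i → UMax L a (f i)
        fᵢ-out = enumerated∈ enum

theorem4p5 : {ℓ : Level} → ExcludedMiddle (lsuc ℓ) →
    (L : ResiduatedLattice ℓ) →
    (∀ a → Rad L a ⇔ (a ≡ ResiduatedLattice.1# L)) →
    ∀ a → Soc L a ⇔ IsFiniteFamily L (UMax L a)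
theorem4p5 em L rad a = mk⇔ (Soc⇒UMax-finite L em) (UMax-finite⇒Soc L em rad)
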